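{- With the precedence $>$ described in the context, every rule of $\mathcal{H}_{\mathrm{lab}}\cup\mathcal{D}\mathrm{ec}$ is oriented by $>_{\mathrm{acmpo}}$, i.e. $\mathcal{H}_{\mathrm{lab}}\cup\mathcal{D}\mathrm{ec}\subseteq{>_{\mathrm{acmpo}}}$.
   Context: Let $\mathbb{O}$ be the set of ordinals below $\varepsilon_0$. The signature consists of constants $\mathsf{h},\mathsf{0}$; unary $\mathsf{I},\mathsf{E},\mathsf{s}$; binary $\mathsf{C},\mathsf{D}$; binary $\mathsf{A}_v,\mathsf{B}_v$ for every $v\in\mathbb{O}$; and the binary AC symbol $\mid$ (written infix), which is the only AC symbol. The infinite TRS $\mathcal{H}_{\mathrm{lab}}$ consists of, for all $v\in\mathbb{O}$: (1) $\mathsf{A}_\omega(n,\mathsf{I}(\mathsf{h}))\to\mathsf{A}_1(\mathsf{s}(n),\mathsf{h})$; (2) $\mathsf{A}_{\omega^{v+1}}(n,\mathsf{I}(\mathsf{h}\mid x))\to\mathsf{A}_{\omega^v}(\mathsf{s}(n),\mathsf{I}(x))$; (3) $\mathsf{A}_{\omega^v}(n,\mathsf{I}(x))\to\mathsf{B}_{\omega^v}(n,\mathsf{D}(\mathsf{s}(n),\mathsf{I}(x)))$; (4) $\mathsf{C}(\mathsf{0},x)\to\mathsf{E}(x)$; (5) $\mathsf{C}(\mathsf{s}(n),x)\to x\mid\mathsf{C}(n,x)$; (6) $\mathsf{I}(\mathsf{E}(x)\mid y)\to\mathsf{E}(\mathsf{I}(x\mid y))$; (7) $\mathsf{I}(\mathsf{E}(x))\to\mathsf{E}(\mathsf{I}(x))$;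 (8) $\mathsf{D}(n,\mathsf{I}(\mathsf{I}(x)))\to\mathsf{I}(\mathsf{D}(n,\mathsf{I}(x)))$; (9) $\mathsf{D}(n,\mathsf{I}(\mathsf{I}(x)\mid y))\to\mathsf{I}(\mathsf{D}(n,\mathsf{I}(x))\mid y)$; (10) $\mathsf{D}(n,\mathsf{I}(\mathsf{I}(\mathsf{h}\mid x)\mid y))\to\mathsf{I}(\mathsf{C}(n,\mathsf{I}(x))\mid y)$; (11) $\mathsf{D}(n,\mathsf{I}(\mathsf{I}(\mathsf{h}\mid x)))\to\mathsf{I}(\mathsf{C}(n,\mathsf{I}(x)))$; (12) $\mathsf{D}(n,\mathsf{I}(\mathsf{I}(\mathsf{h})\mid y))\to\mathsf{I}(\mathsf{C}(n,\mathsf{h})\mid y)$; (13) $\mathsf{D}(n,\mathsf{I}(\mathsf{I}(\mathsf{h})))\to\mathsf{I}(\mathsf{C}(n,\mathsf{h}))$; (14) $\mathsf{B}_{v+1}(n,\mathsf{E}(x))\to\mathsf{A}_v(\mathsf{s}(n),x)$. $\mathcal{D}\mathrm{ec}$ consists of $\mathsf{A}_v(n,x)\to\mathsf{A}_w(n,x)$ and $\mathsf{B}_v(n,x)\to\mathsf{B}_w(n,x)$ for all $v,w\in\mathbb{O}$ with $v>w$. The precedence $>$ is the transitive closure of: $\mathsf{A}_v>\mathsf{A}_w$ and $\mathsf{B}_v>\mathsf{B}_w$ for $v>w$; $\mathsf{B}_{v+1}>\mathsf{A}_v>\mathsf{B}_v$ for all $v\in\mathbb{O}$; $\mathsf{B}_0>\mathsf{s}>\mathsf{D}>\mathsf{C}>\mathsf{I}>\mathsf{E}>{\mid}$.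 $=_{\mathrm{AC}}$ is the congruence generated by associativity and commutativity of $\mid$. $\mathrm{root}(t)$ is $t$ for variables and $f$ for $t=f(t_1,\dots,t_n)$. For non-variable $t=f(t_1,\dots,t_n)$, $\mathrm{TF}(t)=\mathrm{TF}_f(t_1)\uplus\cdots\uplus\mathrm{TF}_f(t_n)$, with $\mathrm{TF}_f(u)=\mathrm{TF}_f(u_1)\uplus\mathrm{TF}_f(u_2)$ if $u=f(u_1,u_2)$ and $f$ is AC, and $\mathrm{TF}_f(u)=\{u\}$ otherwise. $=_{\mathrm{AC}}^{\mathrm{mul}}$: $\varnothing=_{\mathrm{AC}}^{\mathrm{mul}}\varnothing$, $\{s\}\uplus M=_{\mathrm{AC}}^{\mathrm{mul}}\{t\}\uplus N$ if $s=_{\mathrm{AC}}t$ and $M=_{\mathrm{AC}}^{\mathrm{mul}}N$. $s>_{\mathrm{acmpo}}t$ iff $s$ is not a variable and one of: (1) some $s'\in\mathrm{TF}(s)$ has $s'>_{\mathrm{acmpo}}t$ or $s'=_{\mathrm{AC}}t$; (2) $\mathrm{root}(s)>\mathrm{root}(t)$ and $s>_{\mathrm{acmpo}}t'$ for all $t'\in\mathrm{TF}(t)$; (3) $\mathrm{root}(s)=\mathrm{root}(t)$ and there are multisets with $\mathrm{TF}(s)=S_1\uplus S_2$, $\mathrm{TF}(t)=T_1\uplus T_2$, $S_1=_{\mathrm{AC}}^{\mathrm{mul}}T_1$, $S_2\ne\varnothing$, and each $t'\in T_2$ has some $s'\in S_2$ with $s'>_{\mathrm{acmpo}}t'$. 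-}

module Defs where

open import Data.Nat using (ℕ; zero; suc)
open import Data.List using (List; []; _∷_; _++_; concat)
open import Data.List.Relation.Unary.Any using (Any)
open import Data.List.Relation.Unary.All using (All)
open import Data.List.Relation.Binary.Permutation.Propositional using (_↭_)
open import Data.Vec using (Vec; []; _∷_; toList; map)
open import Data.Vec.Relation.Binary.Pointwise.Inductive using (Pointwise)
open import Data.Product using (Σ; ∃; ∃-syntax; _×_; _,_)
open import Data.Sum using (_⊎_)
open import Relation.Binary.PropositionalEquality using (_≡_; _≢_)
open import Relation.Binary.Construct.Closure.Transitive using (TransClosure)

-- Ordinals below ε₀ in Cantor normal form
--   ω^ a + b  denotes  ω^a + b

data Ord : Set where
  𝟎    : Ord
  ω^_+_ : Ord → Ord → Ord

infix 4 _<ₒ_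
data _<ₒ_ : Ord → Ord → Set where
  𝟎<   : ∀ {a b} → 𝟎 <ₒ ω^ a + b
  exp< : ∀ {a b c d} → a <ₒ c → ω^ a + b <ₒ ω^ c + d
  rst< : ∀ {a b c d} → a ≡ c → b <ₒ d → ω^ a + b <ₒ ω^ c + d

data TailOK (a : Ord) : Ord → Set where
  nil  : TailOK a 𝟎
  cons : ∀ {c d} → (c <ₒ a ⊎ c ≡ a) → TailOK a (ω^ c + d)

data IsNF : Ord → Set where
  𝟎-nf : IsNF 𝟎
  ω-nf : ∀ {a b} → IsNF a → IsNF b → TailOK a b → IsNF (ω^ a + b)

𝟏 : Ord
𝟏 = ω^ 𝟎 + 𝟎

ω : Ord
ω = ω^ 𝟏 + 𝟎

ωexp : Ord → Ord
ωexp v = ω^ v + 𝟎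

succₒ : Ord → Ord
succₒ 𝟎 = 𝟏
succₒ (ω^ a + b) = ω^ a + succₒ b

data Sym : Set where
  h 𝟘 I E s C D bar : Sym
  A B : Ord → Sym

arity : Sym → ℕ
arity h = 0
arity 𝟘 = 0
arity I = 1
arity E = 1
arity s = 1
arity C = 2
arity D = 2
arity bar = 2
arity (A _) = 2
arity (B _) = 2

data Term : Set where
  var : ℕ → Term
  fun : (f : Sym) → Vec Term (arity f) → Term


h′ 𝟘′ : Term
h′ = fun h []
𝟘′ = fun 𝟘 []

I′ E′ s′ : Term → Term
I′ t = fun I (t ∷ [])
E′ t = fun E (t ∷ [])
s′ t = fun s (t ∷ [])

C′ D′ _∣_ : Term → Term → Term
C′ t u = fun C (t ∷ u ∷ [])
D′ t u = fun D (t ∷ u ∷ [])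
t ∣ u = fun bar (t ∷ u ∷ [])

A′ B′ : Ord → Term → Term → Term
A′ v t u = fun (A v) (t ∷ u ∷ [])
B′ v t u = fun (B v) (t ∷ u ∷ [])

data PrecGen : Sym → Sym → Set where
  AA   : ∀ {v w} → IsNF v → IsNF w → w <ₒ v → PrecGen (A v) (A w)
  BB   : ∀ {v w} → IsNF v → IsNF w → w <ₒ v → PrecGen (B v) (B w)
  BsA  : ∀ {v} → IsNF v → PrecGen (B (succₒ v)) (A v)
  AB   : ∀ {v} → IsNF v → PrecGen (A v) (B v)
  B0s  : PrecGen (B 𝟎) s
  sD   : PrecGen s D
  DC   : PrecGen D C
  CI   : PrecGen C I
  IE   : PrecGen I E
  Ebar : PrecGen E bar

infix 4 _≻_
_≻_ : Sym → Sym → Set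
_≻_ = TransClosure PrecGen

infix 4 _=AC_
data _=AC_ : Term → Term → Set where
  ac-refl  : ∀ {t} → t =AC t
  ac-sym   : ∀ {t u} → t =AC u → u =AC t
  ac-trans : ∀ {t u w} → t =AC u → u =AC w → t =AC w
  ac-assoc : ∀ {x y z} → ((x ∣ y) ∣ z) =AC (x ∣ (y ∣ z))
  ac-comm  : ∀ {x y} → (x ∣ y) =AC (y ∣ x)
  ac-cong  : ∀ f {ts us} → Pointwise _=AC_ ts us → fun f ts =AC fun f us

-- Top-flattening (multisets as lists up to permutation)

isAC : Sym → Set
isAC f = f ≡ bar

TFbar : Term → List Term
TFbar (fun bar (u₁ ∷ u₂ ∷ [])) = TFbar u₁ ++ TFbar u₂
TFbar u = u ∷ []

TFf : Sym → Term → List Term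
TFf bar u = TFbar u
TFf f   u = u ∷ []

TF : (f : Sym) → Vec Term (arity f) → List Term
TF f ts = concat (toList (map (TFf f) ts))

data MulAC : List Term → List Term → Set where
  mul-[] : MulAC [] []
  mul-∷  : ∀ {s t M N N′} → N ↭ (t ∷ N′) → s =AC t → MulAC M N′ → MulAC (s ∷ M) N

infix 4 _>acmpo_
data _>acmpo_ : Term → Term → Set where
  acmpo1 : ∀ {f ss t} →
           Any (λ s′ → s′ >acmpo t ⊎ s′ =AC t) (TF f ss) →
           fun f ss >acmpo t
  acmpo2 : ∀ {f ss g ts} → f ≻ g →
           All (λ t′ → fun f ss >acmpo t′) (TF g ts) →
           fun f ss >acmpo fun g ts
  acmpo3 : ∀ {f ss ts} (S₁ S₂ T₁ T₂ : List Term) →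
           TF f ss ↭ (S₁ ++ S₂) → TF f ts ↭ (T₁ ++ T₂) →
           MulAC S₁ T₁ → S₂ ≢ [] →
           All (λ t′ → Any (λ s′ → s′ >acmpo t′) S₂) T₂ →
           fun f ss >acmpo fun f ts

n x y : Term
n = var 0
x = var 1
y = var 2

data HlabDec : Term → Term → Set where
  r1  : HlabDec (A′ ω n (I′ h′)) (A′ 𝟏 (s′ n) h′)
  r2  : ∀ {v} → IsNF v →
        HlabDec (A′ (ωexp (succₒ v)) n (I′ (h′ ∣ x))) (A′ (ωexp v) (s′ n) (I′ x))
  r3  : ∀ {v} → IsNF v →
        HlabDec (A′ (ωexp v) n (I′ x)) (B′ (ωexp v) n (D′ (s′ n) (I′ x)))
  r4  : HlabDec (C′ 𝟘′ x) (E′ x)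
  r5  : HlabDec (C′ (s′ n) x) (x ∣ C′ n x)
  r6  : HlabDec (I′ (E′ x ∣ y)) (E′ (I′ (x ∣ y)))
  r7  : HlabDec (I′ (E′ x)) (E′ (I′ x))
  r8  : HlabDec (D′ n (I′ (I′ x))) (I′ (D′ n (I′ x)))
  r9  : HlabDec (D′ n (I′ (I′ x ∣ y))) (I′ (D′ n (I′ x) ∣ y))
  r10 : HlabDec (D′ n (I′ (I′ (h′ ∣ x) ∣ y))) (I′ (C′ n (I′ x) ∣ y))
  r11 : HlabDec (D′ n (I′ (I′ (h′ ∣ x)))) (I′ (C′ n (I′ x)))
  r12 : HlabDec (D′ n (I′ (I′ h′ ∣ y))) (I′ (C′ n h′ ∣ y))
  r13 : HlabDec (D′ n (I′ (I′ h′))) (I′ (C′ n h′))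
  r14 : ∀ {v} → IsNF v →
        HlabDec (B′ (succₒ v) n (E′ x)) (A′ v (s′ n) x)
  decA : ∀ {v w} → IsNF v → IsNF w → w <ₒ v → HlabDec (A′ v n x) (A′ w n x)
  decB : ∀ {v w} → IsNF v → IsNF w → w <ₒ v → HlabDec (B′ v n x) (B′ w n x)

{-# OPTIONS --safe #-}
module Submission where

open import Defs
open import Data.List using ([]; _∷_; _++_)
open import Data.List.Membership.Propositional using (_∈_)
open import Data.List.Relation.Unary.Any as Any using (here; there)
open import Data.List.Membership.Propositional.Properties using (∈-++⁺ˡ; ∈-++⁺ʳ)
open import Data.List.Relation.Unary.All as All using (All; []; _∷_)
open import Data.List.Relation.Unary.All.Properties using (++⁺)
open import Data.List.Relation.Binary.Permutation.Propositional using (_↭_; ↭-refl; ↭-trans)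
open import Data.List.Relation.Binary.Permutation.Propositional.Properties using (shift; ∷↭∷ʳ)
open import Data.Vec using ([]; _∷_)
open import Data.Sum using (inj₁; inj₂)
open import Relation.Binary.PropositionalEquality using (_≡_; refl)
open import Relation.Binary.Construct.Closure.Transitive using ([_]; _∷_; _∷ʳ_)

-- Every rule is oriented by case (2), applied recursively: the left root lies above the right
-- root in the precedence, so it remains to dominate each flattened argument on the right.
-- These are nested flattened subterms of the left-hand side, terms with a root below the
-- left one (such as s(n) below every A and B), or terms sharing their root with a left-hand
-- argument and differing from it in a single smaller flattened argument, which case (3)
-- settles by matching the remaining arguments to themselves.

pattern first  = here refl
pattern second = there (here refl)

v<ₒsuccₒv : ∀ v → v <ₒ succₒ v
v<ₒsuccₒv 𝟎          = 𝟎<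
v<ₒsuccₒv (ω^ a + b) = rst< refl (v<ₒsuccₒv b)

0<ₒsuccₒ : ∀ v → 𝟎 <ₒ succₒ v
0<ₒsuccₒ 𝟎          = 𝟎<
0<ₒsuccₒ (ω^ _ + _) = 𝟎<

TailOK-succₒ : ∀ {a b} → TailOK a b → TailOK a (succₒ b)
TailOK-succₒ {𝟎}        nil      = cons (inj₂ refl)
TailOK-succₒ {ω^ _ + _} nil      = cons (inj₁ 𝟎<)
TailOK-succₒ            (cons p) = cons p

IsNF-succₒ : ∀ {v} → IsNF v → IsNF (succₒ v)
IsNF-succₒ 𝟎-nf         = ω-nf 𝟎-nf 𝟎-nf nil
IsNF-succₒ (ω-nf a b t) = ω-nf a (IsNF-succₒ b) (TailOK-succₒ t)

IsNF-ωexp : ∀ {v} → IsNF v → IsNF (ωexp v)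
IsNF-ωexp nf = ω-nf nf 𝟎-nf nil

IsNF-𝟏 : IsNF 𝟏
IsNF-𝟏 = IsNF-succₒ 𝟎-nf

B≻s : ∀ {v} → IsNF v → 𝟎 <ₒ v → B v ≻ s
B≻s nf 0<v = BB nf 𝟎-nf 0<v ∷ [ B0s ]

A≻s : ∀ {v} → IsNF v → 𝟎 <ₒ v → A v ≻ s
A≻s nf 0<v = AB nf ∷ B≻s nf 0<v

Aωexp≻s : ∀ {v} → IsNF v → A (ωexp v) ≻ s
Aωexp≻s nf = A≻s (IsNF-ωexp nf) 𝟎<

D≻I : D ≻ I
D≻I = DC ∷ [ CI ]

C≻bar : C ≻ bar
C≻bar = CI ∷ IE ∷ [ Ebar ]

D≻bar : D ≻ bar
D≻bar = DC ∷ C≻bar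

MulAC-refl : ∀ M → MulAC M M
MulAC-refl []      = mul-[]
MulAC-refl (t ∷ M) = mul-∷ ↭-refl ac-refl (MulAC-refl M)

>acmpo-∈TF : ∀ {f ss t} → t ∈ TF f ss → fun f ss >acmpo t
>acmpo-∈TF t∈ = acmpo1 (Any.map (λ { refl → inj₂ ac-refl }) t∈)

>acmpo-via-∈TF : ∀ {f ss u t} → u ∈ TF f ss → u >acmpo t → fun f ss >acmpo t
>acmpo-via-∈TF u∈ u>t = acmpo1 (Any.map (λ { refl → inj₁ u>t }) u∈)

>acmpo-s′ : ∀ {f ss t} → f ≻ s → t ∈ TF f ss → fun f ss >acmpo s′ t
>acmpo-s′ f≻s t∈ = acmpo2 f≻s (>acmpo-∈TF t∈ ∷ [])

>acmpo-replace : ∀ L {f ss ts u u′ R} →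
                 TF f ss ≡ L ++ u ∷ R → TF f ts ≡ L ++ u′ ∷ R → u >acmpo u′ →
                 fun f ss >acmpo fun f ts
>acmpo-replace L {u = u} {u′} {R} ss≡ ts≡ u>u′ =
  acmpo3 (L ++ R) (u ∷ []) (L ++ R) (u′ ∷ [])
         (move-to-end ss≡) (move-to-end ts≡) (MulAC-refl (L ++ R)) (λ ()) (here u>u′ ∷ [])
  where
  move-to-end : ∀ {xs w} → xs ≡ L ++ w ∷ R → xs ↭ (L ++ R) ++ w ∷ []
  move-to-end {w = w} refl = ↭-trans (shift w L R) (∷↭∷ʳ w (L ++ R))

I′-mono : ∀ {t u} → t >acmpo u → I′ t >acmpo I′ u
I′-mono = >acmpo-replace [] refl refl

D′-mono : ∀ {m w w′} → w >acmpo w′ → D′ m w >acmpo D′ m w′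
D′-mono {m} = >acmpo-replace (m ∷ []) refl refl

D′-C′ : ∀ {m w t} → w >acmpo t → D′ m w >acmpo C′ m t
D′-C′ w>t = acmpo2 [ DC ] (>acmpo-∈TF first ∷ >acmpo-via-∈TF second w>t ∷ [])

D′-I′-∣ : ∀ {m u z t} → All (D′ m (I′ (u ∣ z)) >acmpo_) (TFbar t) →
          D′ m (I′ (u ∣ z)) >acmpo I′ (t ∣ z)
D′-I′-∣ {u = u} {z} ts< = acmpo2 D≻I (acmpo2 D≻bar (++⁺ ts< (++⁺ zs< [])) ∷ [])
  where
  zs< : All (D′ _ (I′ (u ∣ z)) >acmpo_) (TFbar z)
  zs< = All.tabulate λ w∈ → >acmpo-via-∈TF second (>acmpo-via-∈TF first (>acmpo-∈TF (∈-++⁺ʳ (TFbar u) (∈-++⁺ˡ w∈))))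

r1-oriented : A′ ω n (I′ h′) >acmpo A′ 𝟏 (s′ n) h′
r1-oriented = acmpo2 [ AA (IsNF-ωexp IsNF-𝟏) IsNF-𝟏 (exp< 𝟎<) ]
  (>acmpo-s′ (Aωexp≻s IsNF-𝟏) first ∷ >acmpo-via-∈TF second (>acmpo-∈TF first) ∷ [])

r2-oriented : ∀ {v} → IsNF v →
              A′ (ωexp (succₒ v)) n (I′ (h′ ∣ x)) >acmpo A′ (ωexp v) (s′ n) (I′ x)
r2-oriented {v} nf = acmpo2 [ AA (IsNF-ωexp (IsNF-succₒ nf)) (IsNF-ωexp nf) (exp< (v<ₒsuccₒv v)) ]
  (>acmpo-s′ (Aωexp≻s (IsNF-succₒ nf)) first
   ∷ >acmpo-via-∈TF second (I′-mono (>acmpo-∈TF second)) ∷ [])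

r3-oriented : ∀ {v} → IsNF v → A′ (ωexp v) n (I′ x) >acmpo B′ (ωexp v) n (D′ (s′ n) (I′ x))
r3-oriented nf = acmpo2 [ AB (IsNF-ωexp nf) ]
  (>acmpo-∈TF first
   ∷ acmpo2 (Aωexp≻s nf ∷ʳ sD) (>acmpo-s′ (Aωexp≻s nf) first ∷ >acmpo-∈TF second ∷ [])
   ∷ [])

r14-oriented : ∀ {v} → IsNF v → B′ (succₒ v) n (E′ x) >acmpo A′ v (s′ n) x
r14-oriented {v} nf = acmpo2 [ BsA nf ]
  (>acmpo-s′ (B≻s (IsNF-succₒ nf) (0<ₒsuccₒ v)) first ∷ >acmpo-via-∈TF second (>acmpo-∈TF first) ∷ [])

theorem5p7 : ∀ {l r} → HlabDec l r → l >acmpo r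
theorem5p7 r1 = r1-oriented
theorem5p7 (r2 nf) = r2-oriented nf
theorem5p7 (r3 nf) = r3-oriented nf
theorem5p7 r4 = acmpo2 (CI ∷ [ IE ]) (>acmpo-∈TF second ∷ [])
theorem5p7 r5 = acmpo2 C≻bar (>acmpo-∈TF second ∷ >acmpo-replace [] refl refl (>acmpo-∈TF first) ∷ [])
theorem5p7 r6 = acmpo2 [ IE ] (I′-mono (>acmpo-replace [] refl refl (>acmpo-∈TF first)) ∷ [])
theorem5p7 r7 = acmpo2 [ IE ] (I′-mono (>acmpo-∈TF first) ∷ [])
theorem5p7 r8 = acmpo2 D≻I (D′-mono (>acmpo-∈TF first) ∷ [])
theorem5p7 r9 = D′-I′-∣ (D′-mono (>acmpo-via-∈TF first (>acmpo-∈TF first)) ∷ [])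
theorem5p7 r10 = D′-I′-∣ (D′-C′ (I′-mono (>acmpo-via-∈TF first (>acmpo-via-∈TF first (>acmpo-∈TF second)))) ∷ [])
theorem5p7 r11 = acmpo2 D≻I (D′-C′ (>acmpo-via-∈TF first (I′-mono (>acmpo-∈TF second))) ∷ [])
theorem5p7 r12 = D′-I′-∣ (D′-C′ (>acmpo-via-∈TF first (>acmpo-via-∈TF first (>acmpo-∈TF first))) ∷ [])
theorem5p7 r13 = acmpo2 D≻I (D′-C′ (>acmpo-via-∈TF first (>acmpo-∈TF first)) ∷ [])
theorem5p7 (r14 nf) = r14-oriented nf
theorem5p7 (decA nv nw w<v) = acmpo2 [ AA nv nw w<v ] (>acmpo-∈TF first ∷ >acmpo-∈TF second ∷ [])
theorem5p7 (decB nv nw w<v) = acmpo2 [ BB nv nw w<v ] (>acmpo-∈TF first ∷ >acmpo-∈TF second ∷ [])
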